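{- For every $n\ge 0$, $$\sum_{k=0}^nB_{n-k}^{(-k)}=\frac{(-1)^{n+1}}{2}\sum_{j=1}^{n+1}(-1)^j\,j!\,S(n+1,j)\,\frac{\binom{2j}{j}}{3^{j-1}}\sum_{i=0}^{j-1}\frac{3^i}{(2i+1)\binom{2i}{i}}.$$
   Context: For an integer $k$, $\mathrm{Li}_k(z)=\sum_{m\ge1}z^m/m^k$. The poly-Bernoulli numbers $B_n^{(k)}\in\mathbb Q$ are defined by $\sum_{n\ge0}B_n^{(k)}\frac{t^n}{n!}=\frac{\mathrm{Li}_k(1-e^{ -t})}{1-e^{ -t}}$. $S(n,j)$ denotes the Stirling number of the second kind (the number of partitions of an $n$-element set into $j$ nonempty blocks). -}

module Defs where

open import Data.Nat as ℕ using (ℕ; zero; suc; _∸_)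
open import Data.Nat.Combinatorics using (_C_)
open import Data.Nat using (_!)
open import Data.Integer as ℤ using (ℤ; +_; -[1+_])
open import Data.Rational as ℚ using (ℚ; 0ℚ; 1ℚ; _+_; _*_; -_; _/_)

ι : ℕ → ℚ
ι n = (+ n) / 1

-- reciprocal of a positive natural (inv 0 = 0 is never used below)
inv : ℕ → ℚ
inv zero    = 0ℚ
inv (suc d) = (+ 1) / suc d

sgn : ℕ → ℚ
sgn zero    = 1ℚ
sgn (suc n) = - sgn n

Σ< : ℕ → (ℕ → ℚ) → ℚ
Σ< zero    f = 0ℚ
Σ< (suc n) f = Σ< n f + f n

S : ℕ → ℕ → ℕ
S zero    zero    = 1
S zero    (suc j) = 0
S (suc n) zero    = 0
S (suc n) (suc j) = suc j ℕ.* S n (suc j) ℕ.+ S n j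

-- formal power series over ℚ, as coefficient sequences (coefficient of t^n)
FPS : Set
FPS = ℕ → ℚ

_⊛_ : FPS → FPS → FPS
(f ⊛ g) n = Σ< (suc n) (λ i → f i * g (n ∸ i))

one : FPS
one zero    = 1ℚ
one (suc n) = 0ℚ

pow : FPS → ℕ → FPS
pow f zero    = one
pow f (suc m) = f ⊛ pow f m

-- 1 - e^{-t} = Σ_{n≥1} -(-1)^n t^n / n!
oneMinusExpNeg : FPS
oneMinusExpNeg zero    = 0ℚ
oneMinusExpNeg (suc n) = - (sgn (suc n) * inv (suc n !))

-- m^{-k} for an integer k (m ≥ 1)
powNeg : ℕ → ℤ → ℚ
powNeg m (+ a)      = inv (m ℕ.^ a)
powNeg m -[1+ a ]   = ι (m ℕ.^ suc a)

-- Li_k(1-e^{-t})/(1-e^{-t}) = Σ_{m≥1} (1-e^{-t})^{m-1} / m^k.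
-- Since (1-e^{-t})^{m-1} = O(t^{m-1}), only m ≤ n+1 contribute to t^n.
-- B_n^{(k)} = n! · [t^n] of that series.
polyBernoulli : ℕ → ℤ → ℚ
polyBernoulli n k =
  ι (n !) * Σ< (suc n) (λ m → powNeg (suc m) k * pow oneMinusExpNeg m n)

module Submission where

-- By the closed formula B_N^(-k) = Σ_m (-1)^(N+m) m! S(N,m) (m+1)^k, which comes from
-- N! [t^N] (1 - e^(-t))^m = (-1)^(N+m) m! S(N,m), the left side equals
-- Σ_m m! Σ_k (-1)^(n-k+m) S(n-k,m) (m+1)^k. Running the recurrence
-- S(n+2,j+1) = (j+1) S(n+1,j+1) + S(n+1,j) backwards rewrites each inner sum as
-- Σ_j (-1)^(n+j) S(n+1,j+1) (m+j+1)!/(2m+1)!, so the left side is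
-- Σ_j (-1)^(n+j) S(n+1,j+1) T_j with T_j = Σ_(m≤j) m! (m+j+1)!/(2m+1)!. Consecutive
-- summands of T_j have ratio (m+j+2)/(2(2m+3)); telescoping gives
-- 3 T_(j+1) = (4j+6) T_j + 3 (j+1)!, whose solution with T_0 = 1 is
-- 2·3^j T_j = (j+1)! C(2j+2,j+1) Σ_(i≤j) 3^i / ((2i+1) C(2i,i)).

open import Algebra.Bundles using (CommutativeSemiring; CommutativeRing)
open import Data.Empty using (⊥-elim)
open import Data.Nat using (ℕ; zero; suc; _∸_; _!; _^_; _≤_; _<_; z≤n; s≤s; NonZero)
import Data.Nat as ℕ
import Data.Nat.Properties as ℕP
open import Data.Sum using (inj₁; inj₂)
open import Function using (_∘_)
open import Level using (Level; 0ℓ)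
import Relation.Binary.PropositionalEquality as ≡

module Summation {c ℓ : Level} (R : CommutativeSemiring c ℓ) where

  open CommutativeSemiring R
  open import Algebra.Properties.CommutativeSemigroup +-commutativeSemigroup using (interchange)
  open import Relation.Binary.Reasoning.Setoid setoid

  -- Stated for any ∑ obeying the defining equations of Σ<, so as to serve both Σ< over ℚ
  -- and sums of natural numbers.
  module Properties
    (∑ : ℕ → (ℕ → Carrier) → Carrier)
    (∑-zero : ∀ f → ∑ 0 f ≈ 0#)
    (∑-suc : ∀ n f → ∑ (suc n) f ≈ ∑ n f + f n)
    where

    ∑-cong : ∀ n {f g : ℕ → Carrier} → (∀ i → i < n → f i ≈ g i) → ∑ n f ≈ ∑ n g
    ∑-cong zero {f} {g} _ = trans (∑-zero f) (sym (∑-zero g))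
    ∑-cong (suc n) {f} {g} f≈g = begin
      ∑ (suc n) f  ≈⟨ ∑-suc n f ⟩
      ∑ n f + f n  ≈⟨ +-cong (∑-cong n (λ i i<n → f≈g i (ℕP.m<n⇒m<1+n i<n))) (f≈g n ℕP.≤-refl) ⟩
      ∑ n g + g n  ≈⟨ ∑-suc n g ⟨
      ∑ (suc n) g  ∎

    ∑-zeros : ∀ n {f : ℕ → Carrier} → (∀ i → i < n → f i ≈ 0#) → ∑ n f ≈ 0#
    ∑-zeros zero {f} _ = ∑-zero f
    ∑-zeros (suc n) {f} f≈0 = begin
      ∑ (suc n) f  ≈⟨ ∑-suc n f ⟩
      ∑ n f + f n  ≈⟨ +-cong (∑-zeros n (λ i i<n → f≈0 i (ℕP.m<n⇒m<1+n i<n))) (f≈0 n ℕP.≤-refl) ⟩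
      0# + 0#      ≈⟨ +-identityˡ 0# ⟩
      0#           ∎

    ∑-distrib-+ : ∀ n (f g : ℕ → Carrier) → ∑ n (λ i → f i + g i) ≈ ∑ n f + ∑ n g
    ∑-distrib-+ zero f g = begin
      ∑ 0 (λ i → f i + g i)  ≈⟨ ∑-zero _ ⟩
      0#                     ≈⟨ +-identityˡ 0# ⟨
      0# + 0#                ≈⟨ +-cong (∑-zero f) (∑-zero g) ⟨
      ∑ 0 f + ∑ 0 g          ∎
    ∑-distrib-+ (suc n) f g = begin
      ∑ (suc n) (λ i → f i + g i)          ≈⟨ ∑-suc n _ ⟩
      ∑ n (λ i → f i + g i) + (f n + g n)  ≈⟨ +-congʳ (∑-distrib-+ n f g) ⟩
      (∑ n f + ∑ n g) + (f n + g n)        ≈⟨ interchange (∑ n f) (∑ n g) (f n) (g n) ⟩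
      (∑ n f + f n) + (∑ n g + g n)        ≈⟨ +-cong (∑-suc n f) (∑-suc n g) ⟨
      ∑ (suc n) f + ∑ (suc n) g            ∎

    ∑-distribˡ : ∀ n a (f : ℕ → Carrier) → a * ∑ n f ≈ ∑ n (λ i → a * f i)
    ∑-distribˡ zero a f = begin
      a * ∑ 0 f            ≈⟨ *-congˡ (∑-zero f) ⟩
      a * 0#               ≈⟨ zeroʳ a ⟩
      0#                   ≈⟨ ∑-zero _ ⟨
      ∑ 0 (λ i → a * f i)  ∎
    ∑-distribˡ (suc n) a f = begin
      a * ∑ (suc n) f                ≈⟨ *-congˡ (∑-suc n f) ⟩
      a * (∑ n f + f n)              ≈⟨ distribˡ a (∑ n f) (f n) ⟩
      a * ∑ n f + a * f n            ≈⟨ +-congʳ (∑-distribˡ n a f) ⟩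
      ∑ n (λ i → a * f i) + a * f n  ≈⟨ ∑-suc n _ ⟨
      ∑ (suc n) (λ i → a * f i)      ∎

    ∑-head : ∀ n (f : ℕ → Carrier) → ∑ (suc n) f ≈ f 0 + ∑ n (λ i → f (suc i))
    ∑-head zero f = begin
      ∑ 1 f                        ≈⟨ ∑-suc 0 f ⟩
      ∑ 0 f + f 0                  ≈⟨ +-congʳ (∑-zero f) ⟩
      0# + f 0                     ≈⟨ +-comm 0# (f 0) ⟩
      f 0 + 0#                     ≈⟨ +-congˡ (∑-zero _) ⟨
      f 0 + ∑ 0 (λ i → f (suc i))  ∎
    ∑-head (suc n) f = begin
      ∑ (suc (suc n)) f                          ≈⟨ ∑-suc (suc n) f ⟩
      ∑ (suc n) f + f (suc n)                    ≈⟨ +-congʳ (∑-head n f) ⟩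
      (f 0 + ∑ n (λ i → f (suc i))) + f (suc n)  ≈⟨ +-assoc (f 0) _ _ ⟩
      f 0 + (∑ n (λ i → f (suc i)) + f (suc n))  ≈⟨ +-congˡ (∑-suc n _) ⟨
      f 0 + ∑ (suc n) (λ i → f (suc i))          ∎

    ∑-comm : ∀ m n (f : ℕ → ℕ → Carrier) →
             ∑ m (λ i → ∑ n (λ j → f i j)) ≈ ∑ n (λ j → ∑ m (λ i → f i j))
    ∑-comm zero n f = begin
      ∑ 0 (λ i → ∑ n (f i))          ≈⟨ ∑-zero _ ⟩
      0#                             ≈⟨ ∑-zeros n (λ j _ → ∑-zero _) ⟨
      ∑ n (λ j → ∑ 0 (λ i → f i j))  ∎
    ∑-comm (suc m) n f = begin
      ∑ (suc m) (λ i → ∑ n (f i))                ≈⟨ ∑-suc m _ ⟩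
      ∑ m (λ i → ∑ n (f i)) + ∑ n (f m)          ≈⟨ +-congʳ (∑-comm m n f) ⟩
      ∑ n (λ j → ∑ m (λ i → f i j)) + ∑ n (f m)  ≈⟨ ∑-distrib-+ n _ (f m) ⟨
      ∑ n (λ j → ∑ m (λ i → f i j) + f m j)      ≈⟨ ∑-cong n (λ j _ → ∑-suc m _) ⟨
      ∑ n (λ j → ∑ (suc m) (λ i → f i j))        ∎

    ∑-extend : ∀ {m n} (f : ℕ → Carrier) → m ≤ n → (∀ i → m ≤ i → i < n → f i ≈ 0#) →
               ∑ m f ≈ ∑ n f
    ∑-extend {m} {zero} f z≤n _ = refl
    ∑-extend {m} {suc n} f m≤1+n f≈0 with ℕP.m≤n⇒m<n∨m≡n m≤1+n
    ... | inj₂ ≡.refl = refl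
    ... | inj₁ m<1+n = begin
      ∑ m f        ≈⟨ ∑-extend f m≤n (λ i m≤i i<n → f≈0 i m≤i (ℕP.m<n⇒m<1+n i<n)) ⟩
      ∑ n f        ≈⟨ +-identityʳ (∑ n f) ⟨
      ∑ n f + 0#   ≈⟨ +-congˡ (f≈0 n m≤n ℕP.≤-refl) ⟨
      ∑ n f + f n  ≈⟨ ∑-suc n f ⟨
      ∑ (suc n) f  ∎
      where m≤n = ℕP.≤-pred m<1+n

open import Defs
open import Data.Nat.Combinatorics
  using (_C_; nCk+nC[k+1]≡[n+1]C[k+1]; k>n⇒nCk≡0; nCk≡n!/k![n-k]!; k![n∸k]!∣n!)
open import Data.Nat.DivMod using (m/n*n≡m)
open import Data.Nat.Tactic.RingSolver using (solve-∀)
open import Relation.Binary.PropositionalEquality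

sumℕ : ℕ → (ℕ → ℕ) → ℕ
sumℕ zero    f = 0
sumℕ (suc n) f = sumℕ n f ℕ.+ f n

module ℕΣ = Summation.Properties ℕP.+-*-commutativeSemiring sumℕ (λ _ → refl) (λ _ _ → refl)

-- Identities in ℕ, scoped so that _+_ and _*_ can mean ℚ's operations afterwards.
module _ where

  open import Data.Nat using (_+_; _*_)
  open ≡-Reasoning

  S-vanish : ∀ {n m} → n < m → S n m ≡ 0
  S-vanish {zero}  {suc m} _         = refl
  S-vanish {suc n} {suc m} (s≤s n<m) = begin
    suc m * S n (suc m) + S n m  ≡⟨ cong₂ (λ x y → suc m * x + y)
                                          (S-vanish (ℕP.m<n⇒m<1+n n<m)) (S-vanish n<m) ⟩
    suc m * 0 + 0                ≡⟨ cong (_+ 0) (ℕP.*-zeroʳ (suc m)) ⟩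
    0                            ∎

  binomial-convolution-suc : ∀ n (g : ℕ → ℕ) →
    sumℕ (suc (suc n)) (λ i → (suc n C i) * g (suc n ∸ i))
      ≡ sumℕ (suc n) (λ i → (n C i) * g (suc (n ∸ i))) + sumℕ (suc n) (λ i → (n C i) * g (n ∸ i))
  binomial-convolution-suc n g = begin
    sumℕ (suc (suc n)) (λ i → (suc n C i) * g (suc n ∸ i))
      ≡⟨ ℕΣ.∑-head (suc n) _ ⟩
    1 * g (suc n) + sumℕ (suc n) (λ i → (suc n C suc i) * g (n ∸ i))
      ≡⟨ cong (1 * g (suc n) +_) (trans (ℕΣ.∑-cong (suc n) (λ i _ → pascal i)) (ℕΣ.∑-distrib-+ (suc n) _ _)) ⟩
    1 * g (suc n) + (B + sumℕ (suc n) (λ i → (n C suc i) * g (n ∸ i)))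
      ≡⟨ swap-last (1 * g (suc n)) B _ ⟩
    (1 * g (suc n) + sumℕ (suc n) (λ i → (n C suc i) * g (n ∸ i))) + B
      ≡⟨ cong (_+ B) (ℕΣ.∑-head (suc n) (λ i → (n C i) * g (suc n ∸ i))) ⟨
    sumℕ (suc (suc n)) (λ i → (n C i) * g (suc n ∸ i)) + B
      ≡⟨ cong (_+ B) (ℕΣ.∑-extend _ (ℕP.n≤1+n (suc n)) beyond) ⟨
    sumℕ (suc n) (λ i → (n C i) * g (suc n ∸ i)) + B
      ≡⟨ cong (_+ B) (ℕΣ.∑-cong (suc n) (λ i i≤n →
           cong (λ k → (n C i) * g k) (ℕP.+-∸-assoc 1 (ℕP.≤-pred i≤n)))) ⟩
    sumℕ (suc n) (λ i → (n C i) * g (suc (n ∸ i))) + B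
      ∎
    where
    B = sumℕ (suc n) (λ i → (n C i) * g (n ∸ i))
    swap-last : ∀ a b c → a + (b + c) ≡ (a + c) + b
    swap-last = solve-∀
    pascal : ∀ i → (suc n C suc i) * g (n ∸ i) ≡ (n C i) * g (n ∸ i) + (n C suc i) * g (n ∸ i)
    pascal i = trans (cong (_* g (n ∸ i)) (sym (nCk+nC[k+1]≡[n+1]C[k+1] n i)))
                     (ℕP.*-distribʳ-+ (g (n ∸ i)) (n C i) (n C suc i))
    beyond : ∀ i → suc n ≤ i → i < suc (suc n) → (n C i) * g (suc n ∸ i) ≡ 0
    beyond i n<i _ = cong (_* g (suc n ∸ i)) (k>n⇒nCk≡0 n<i)

  S-binomial : ∀ n m → sumℕ (suc n) (λ i → (n C i) * S (n ∸ i) m) ≡ S (suc n) (suc m)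
  S-binomial zero    m = base (S 0 m) m
    where
    base : ∀ x m → 0 + 1 * x ≡ suc m * 0 + x
    base = solve-∀
  S-binomial (suc n) m = begin
    sumℕ (suc (suc n)) (λ i → (suc n C i) * S (suc n ∸ i) m)
      ≡⟨ binomial-convolution-suc n (λ k → S k m) ⟩
    sumℕ (suc n) (λ i → (n C i) * S (suc (n ∸ i)) m) + sumℕ (suc n) (λ i → (n C i) * S (n ∸ i) m)
      ≡⟨ cong₂ _+_ (shifted m) (S-binomial n m) ⟩
    m * S (suc n) (suc m) + S (suc n) m + S (suc n) (suc m)
      ≡⟨ regroup m (S (suc n) (suc m)) (S (suc n) m) ⟩
    S (suc (suc n)) (suc m)
      ∎
    where
    regroup : ∀ m x y → m * x + y + x ≡ suc m * x + y
    regroup = solve-∀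
    distrib : ∀ c m x y → c * (m * x + y) ≡ m * (c * x) + c * y
    distrib = solve-∀
    shifted : ∀ m → sumℕ (suc n) (λ i → (n C i) * S (suc (n ∸ i)) m) ≡ m * S (suc n) (suc m) + S (suc n) m
    shifted zero     = ℕΣ.∑-zeros (suc n) (λ i _ → ℕP.*-zeroʳ (n C i))
    shifted (suc m′) = begin
      sumℕ (suc n) (λ i → (n C i) * (suc m′ * S (n ∸ i) (suc m′) + S (n ∸ i) m′))
        ≡⟨ ℕΣ.∑-cong (suc n) (λ i _ → distrib (n C i) (suc m′) (S (n ∸ i) (suc m′)) (S (n ∸ i) m′)) ⟩
      sumℕ (suc n) (λ i → suc m′ * ((n C i) * S (n ∸ i) (suc m′)) + (n C i) * S (n ∸ i) m′)
        ≡⟨ ℕΣ.∑-distrib-+ (suc n) _ _ ⟩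
      sumℕ (suc n) (λ i → suc m′ * ((n C i) * S (n ∸ i) (suc m′))) + A m′
        ≡⟨ cong (_+ A m′) (ℕΣ.∑-distribˡ (suc n) (suc m′) _) ⟨
      suc m′ * A (suc m′) + A m′
        ≡⟨ cong₂ (λ x y → suc m′ * x + y) (S-binomial n (suc m′)) (S-binomial n m′) ⟩
      suc m′ * S (suc n) (suc (suc m′)) + S (suc n) (suc m′)
        ∎
      where
      A : ℕ → ℕ
      A k = sumℕ (suc n) (λ i → (n C i) * S (n ∸ i) k)

  S-binomial-tail : ∀ n m → sumℕ n (λ i → (n C suc i) * S (n ∸ suc i) m) ≡ suc m * S n (suc m)
  S-binomial-tail n m = ℕP.+-cancelˡ-≡ (S n m) _ _ (begin
    S n m + tail                               ≡⟨ cong (_+ tail) (ℕP.*-identityˡ (S n m)) ⟨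
    1 * S n m + tail                           ≡⟨ ℕΣ.∑-head n _ ⟨
    sumℕ (suc n) (λ i → (n C i) * S (n ∸ i) m) ≡⟨ S-binomial n m ⟩
    suc m * S n (suc m) + S n m                ≡⟨ ℕP.+-comm (suc m * S n (suc m)) (S n m) ⟩
    S n m + suc m * S n (suc m)                ∎)
    where
    tail = sumℕ n (λ i → (n C suc i) * S (n ∸ suc i) m)

  binomial-factorials : ∀ {n k} → k ≤ n → (n C k) * (k ! * (n ∸ k) !) ≡ n !
  binomial-factorials {n} {k} k≤n =
    trans (cong (_* (k ! * (n ∸ k) !)) (nCk≡n!/k![n-k]! k≤n))
          (m/n*n≡m {{k ℕP.!* (n ∸ k) !≢0}} (k![n∸k]!∣n! k≤n))

  central-binomial-factorials : ∀ a → ((2 * a) C a) * (a ! * a !) ≡ (2 * a) !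
  central-binomial-factorials a =
    subst (λ k → ((2 * a) C a) * (a ! * k !) ≡ (2 * a) !) 2a∸a≡a (binomial-factorials (ℕP.m≤m+n a (a + 0)))
    where
    2a∸a≡a : 2 * a ∸ a ≡ a
    2a∸a≡a = trans (ℕP.m+n∸m≡n a (a + 0)) (ℕP.+-identityʳ a)

  central-binomial-nonZero : ∀ a → NonZero ((2 * a) C a)
  central-binomial-nonZero a = ℕP.m*n≢0⇒m≢0 ((2 * a) C a)
    {{subst NonZero (sym (central-binomial-factorials a)) ((2 * a) ℕP.!≢0)}}

  central-binomial-suc : ∀ a → suc a * ((2 * suc a) C suc a) ≡ 2 * suc (2 * a) * ((2 * a) C a)
  central-binomial-suc a =
    ℕP.*-cancelʳ-≡ _ _ (suc a * (a ! * a !)) {{ℕP.m*n≢0 (suc a) _ {{_}} {{a ℕP.!* a !≢0}}}} (begin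
    suc a * C₁ * (suc a * (a ! * a !))                     ≡⟨ regroup₁ (suc a) C₁ (a !) ⟩
    C₁ * (suc a ! * suc a !)                               ≡⟨ central-binomial-factorials (suc a) ⟩
    (2 * suc a) !                                          ≡⟨ cong _! (ℕP.*-suc 2 a) ⟩
    suc (suc (2 * a)) * (suc (2 * a) * (2 * a) !)          ≡⟨ cong (λ x → suc (suc (2 * a)) * (suc (2 * a) * x))
                                                                   (central-binomial-factorials a) ⟨
    suc (suc (2 * a)) * (suc (2 * a) * (C₀ * (a ! * a !))) ≡⟨ regroup₂ a C₀ (a !) ⟩
    2 * suc (2 * a) * C₀ * (suc a * (a ! * a !))           ∎)
    where
    C₁ = (2 * suc a) C suc a
    C₀ = (2 * a) C a
    regroup₁ : ∀ b c f → b * c * (b * (f * f)) ≡ c * ((b * f) * (b * f))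
    regroup₁ = solve-∀
    regroup₂ : ∀ a c f →
      suc (suc (2 * a)) * (suc (2 * a) * (c * (f * f))) ≡ 2 * suc (2 * a) * c * (suc a * (f * f))
    regroup₂ = solve-∀

  K : ℕ → ℕ
  K j = suc j ! * ((2 * suc j) C suc j)

  K-suc : ∀ j → K (suc j) ≡ (4 * j + 6) * K j
  K-suc j = begin
    suc (suc j) * suc j ! * C₁              ≡⟨ swap (suc (suc j)) (suc j !) C₁ ⟩
    suc j ! * (suc (suc j) * C₁)            ≡⟨ cong (suc j ! *_) (central-binomial-suc (suc j)) ⟩
    suc j ! * (2 * suc (2 * suc j) * C₀)    ≡⟨ regroup j (suc j !) C₀ ⟩
    (4 * j + 6) * K j                       ∎
    where
    C₁ = (2 * suc (suc j)) C suc (suc j)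
    C₀ = (2 * suc j) C suc j
    swap : ∀ a f c → a * f * c ≡ f * (a * c)
    swap = solve-∀
    regroup : ∀ j f c → f * (2 * suc (2 * suc j) * c) ≡ (4 * j + 6) * (f * c)
    regroup = solve-∀

  K-suc-factor : ∀ j → (4 * j + 6) * K j ≡ 2 * suc j ! * (suc (2 * suc j) * ((2 * suc j) C suc j))
  K-suc-factor j = regroup j (suc j !) ((2 * suc j) C suc j)
    where
    regroup : ∀ j f c → (4 * j + 6) * (f * c) ≡ 2 * f * (suc (2 * suc j) * c)
    regroup = solve-∀

  δ : ℕ → ℕ → ℕ
  δ zero    zero    = 1
  δ zero    (suc _) = 0
  δ (suc _) zero    = 0
  δ (suc a) (suc b) = δ a b

  δ-refl : ∀ c → δ c c ≡ 1
  δ-refl zero    = refl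
  δ-refl (suc c) = δ-refl c

  δ-≢ : ∀ {a b} → a ≢ b → δ a b ≡ 0
  δ-≢ {zero}  {zero}  a≢b = ⊥-elim (a≢b refl)
  δ-≢ {zero}  {suc b} _   = refl
  δ-≢ {suc a} {zero}  _   = refl
  δ-≢ {suc a} {suc b} a≢b = δ-≢ (a≢b ∘ cong suc)

  -- F m j = (m + j + 1)! / (2m + 1)! for m ≤ j, and F m j = 0 for j < m.
  F : ℕ → ℕ → ℕ
  F m zero    = δ m zero
  F m (suc j) = δ m (suc j) + (m + suc (suc j)) * F m j

  F-vanish : ∀ {m j} → j < m → F m j ≡ 0
  F-vanish {suc m} {zero}  _   = refl
  F-vanish {m}     {suc j} j<m = begin
    δ m (suc j) + (m + suc (suc j)) * F m j  ≡⟨ cong₂ (λ x y → x + (m + suc (suc j)) * y)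
                                                      (δ-≢ (ℕP.>⇒≢ j<m)) (F-vanish (ℕP.<-trans (ℕP.n<1+n j) j<m)) ⟩
    0 + (m + suc (suc j)) * 0                ≡⟨ ℕP.*-zeroʳ (m + suc (suc j)) ⟩
    0                                        ∎

  F-diag : ∀ m → F m m ≡ 1
  F-diag zero    = refl
  F-diag (suc m) = begin
    δ m m + (suc m + suc (suc m)) * F (suc m) m  ≡⟨ cong₂ (λ x y → x + (suc m + suc (suc m)) * y)
                                                          (δ-refl m) (F-vanish (ℕP.n<1+n m)) ⟩
    1 + (suc m + suc (suc m)) * 0                ≡⟨ cong suc (ℕP.*-zeroʳ (suc m + suc (suc m))) ⟩
    1                                            ∎

  F-step : ∀ {m j} → m ≤ j → F m (suc j) ≡ (m + suc (suc j)) * F m j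
  F-step {m} {j} m≤j = cong (_+ (m + suc (suc j)) * F m j) (δ-≢ (ℕP.<⇒≢ (s≤s m≤j)))

  F-zero : ∀ j → F 0 j ≡ suc j !
  F-zero zero    = refl
  F-zero (suc j) = trans (F-step {0} {j} z≤n) (cong (suc (suc j) *_) (F-zero j))

  F-ratio : ∀ {m j} → m < j → (suc m + suc m) * suc (suc m + suc m) * F (suc m) j ≡ (m + suc (suc j)) * F m j
  F-ratio {m} {suc j} (s≤s m≤j) with ℕP.m≤n⇒m<n∨m≡n m≤j
  ... | inj₂ refl = begin
    A * F (suc m) (suc m)                                 ≡⟨ cong (A *_) (F-diag (suc m)) ⟩
    A * 1                                                 ≡⟨ base m ⟩
    (m + suc (suc (suc m))) * ((m + suc (suc m)) * 1)     ≡⟨ cong (λ x → (m + suc (suc (suc m))) * ((m + suc (suc m)) * x))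
                                                                 (F-diag m) ⟨
    (m + suc (suc (suc m))) * ((m + suc (suc m)) * F m m) ≡⟨ cong ((m + suc (suc (suc m))) *_) (F-step {m} {m} ℕP.≤-refl) ⟨
    (m + suc (suc (suc m))) * F m (suc m)                 ∎
    where
    A = (suc m + suc m) * suc (suc m + suc m)
    base : ∀ m → (suc m + suc m) * suc (suc m + suc m) * 1 ≡ (m + suc (suc (suc m))) * ((m + suc (suc m)) * 1)
    base = solve-∀
  ... | inj₁ m<j = begin
    A * F (suc m) (suc j)                                 ≡⟨ cong (A *_) (F-step m<j) ⟩
    A * ((suc m + suc (suc j)) * F (suc m) j)             ≡⟨ swap A (suc m + suc (suc j)) (F (suc m) j) ⟩
    (suc m + suc (suc j)) * (A * F (suc m) j)             ≡⟨ cong₂ _*_ (sym (ℕP.+-suc m (suc (suc j)))) (F-ratio m<j) ⟩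
    (m + suc (suc (suc j))) * ((m + suc (suc j)) * F m j) ≡⟨ cong ((m + suc (suc (suc j))) *_) (F-step m≤j) ⟨
    (m + suc (suc (suc j))) * F m (suc j)                 ∎
    where
    A = (suc m + suc m) * suc (suc m + suc m)
    swap : ∀ a k f → a * (k * f) ≡ k * (a * f)
    swap = solve-∀

  t : ℕ → ℕ → ℕ
  t m j = m ! * F m j

  T : ℕ → ℕ
  T j = sumℕ (suc j) (λ m → t m j)

  t-step : ∀ {m j} → m ≤ j → t m (suc j) ≡ (m + suc (suc j)) * t m j
  t-step {m} {j} m≤j = trans (cong (m ! *_) (F-step m≤j)) (swap (m !) (m + suc (suc j)) (F m j))
    where
    swap : ∀ a k f → a * (k * f) ≡ k * (a * f)
    swap = solve-∀

  t-ratio : ∀ {m j} → m < j → (4 * suc m + 2) * t (suc m) j ≡ (m + suc (suc j)) * t m j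
  t-ratio {m} {j} m<j = begin
    (4 * suc m + 2) * (suc m * m ! * F (suc m) j)                 ≡⟨ regroup m (m !) (F (suc m) j) ⟩
    m ! * ((suc m + suc m) * suc (suc m + suc m) * F (suc m) j)   ≡⟨ cong (m ! *_) (F-ratio m<j) ⟩
    m ! * ((m + suc (suc j)) * F m j)                             ≡⟨ swap (m !) (m + suc (suc j)) (F m j) ⟩
    (m + suc (suc j)) * t m j                                     ∎
    where
    regroup : ∀ m f x → (4 * suc m + 2) * (suc m * f * x) ≡ f * ((suc m + suc m) * suc (suc m + suc m) * x)
    regroup = solve-∀
    swap : ∀ a k f → a * (k * f) ≡ k * (a * f)
    swap = solve-∀

  sumℕ-affine : ∀ N a b (f : ℕ → ℕ) →
    sumℕ N (λ m → (a * m + b) * f m) ≡ a * sumℕ N (λ m → m * f m) + b * sumℕ N f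
  sumℕ-affine N a b f = begin
    sumℕ N (λ m → (a * m + b) * f m)                      ≡⟨ ℕΣ.∑-cong N (λ m _ → distrib a m b (f m)) ⟩
    sumℕ N (λ m → a * (m * f m) + b * f m)                ≡⟨ ℕΣ.∑-distrib-+ N _ _ ⟩
    sumℕ N (λ m → a * (m * f m)) + sumℕ N (λ m → b * f m) ≡⟨ cong₂ _+_ (ℕΣ.∑-distribˡ N a _) (ℕΣ.∑-distribˡ N b f) ⟨
    a * sumℕ N (λ m → m * f m) + b * sumℕ N f             ∎
    where
    distrib : ∀ a m b x → (a * m + b) * x ≡ a * (m * x) + b * x
    distrib = solve-∀

  -- By t-ratio, the left sum is the right one shifted by one index;
  -- the boundary terms 2 · t 0 j and (2j + 2) · t j j both equal 2 (j + 1)!.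
  T-telescope : ∀ j →
    sumℕ (suc j) (λ m → (4 * m + 2) * t m j) ≡ sumℕ (suc j) (λ m → (1 * m + suc (suc j)) * t m j)
  T-telescope j = begin
    sumℕ (suc j) (λ m → (4 * m + 2) * t m j)                  ≡⟨ ℕΣ.∑-head j _ ⟩
    2 * t 0 j + sumℕ j (λ m → (4 * suc m + 2) * t (suc m) j)  ≡⟨ cong₂ _+_ boundary (ℕΣ.∑-cong j (λ m m<j → ratio m<j)) ⟩
    w j * t j j + sumℕ j (λ m → w m * t m j)                  ≡⟨ ℕP.+-comm (w j * t j j) (sumℕ j (λ m → w m * t m j)) ⟩
    sumℕ (suc j) (λ m → w m * t m j)                          ∎
    where
    w : ℕ → ℕ
    w m = 1 * m + suc (suc j)
    ratio : ∀ {m} → m < j → (4 * suc m + 2) * t (suc m) j ≡ w m * t m j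
    ratio {m} m<j = trans (t-ratio m<j) (cong (λ x → (x + suc (suc j)) * t m j) (sym (ℕP.*-identityˡ m)))
    boundary′ : ∀ j f → 2 * (1 * (suc j * f)) ≡ (1 * j + suc (suc j)) * (f * 1)
    boundary′ = solve-∀
    boundary : 2 * t 0 j ≡ (1 * j + suc (suc j)) * t j j
    boundary = begin
      2 * (1 * F 0 j)                       ≡⟨ cong (λ x → 2 * (1 * x)) (F-zero j) ⟩
      2 * (1 * (suc j * j !))               ≡⟨ boundary′ j (j !) ⟩
      (1 * j + suc (suc j)) * (j ! * 1)     ≡⟨ cong (λ x → (1 * j + suc (suc j)) * (j ! * x)) (F-diag j) ⟨
      (1 * j + suc (suc j)) * t j j         ∎

  T-moment : ∀ j → 3 * sumℕ (suc j) (λ m → m * t m j) ≡ j * T j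
  T-moment j = ℕP.+-cancelʳ-≡ (W + 2 * T j) _ _ (begin
    3 * W + (W + 2 * T j)                               ≡⟨ expand₁ W (T j) ⟩
    4 * W + 2 * T j                                     ≡⟨ sumℕ-affine (suc j) 4 2 (λ m → t m j) ⟨
    sumℕ (suc j) (λ m → (4 * m + 2) * t m j)            ≡⟨ T-telescope j ⟩
    sumℕ (suc j) (λ m → (1 * m + suc (suc j)) * t m j)  ≡⟨ sumℕ-affine (suc j) 1 (suc (suc j)) (λ m → t m j) ⟩
    1 * W + suc (suc j) * T j                           ≡⟨ expand₂ W j (T j) ⟩
    j * T j + (W + 2 * T j)                             ∎)
    where
    W = sumℕ (suc j) (λ m → m * t m j)
    expand₁ : ∀ w x → 3 * w + (w + 2 * x) ≡ 4 * w + 2 * x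
    expand₁ = solve-∀
    expand₂ : ∀ w j x → 1 * w + suc (suc j) * x ≡ j * x + (w + 2 * x)
    expand₂ = solve-∀

  T-suc : ∀ j → 3 * T (suc j) ≡ (4 * j + 6) * T j + 3 * suc j !
  T-suc j = begin
    3 * (sumℕ (suc j) (λ m → t m (suc j)) + suc j ! * F (suc j) (suc j))
      ≡⟨ cong₂ (λ x y → 3 * (x + suc j ! * y))
               (ℕΣ.∑-cong (suc j) (λ m m≤j → step (ℕP.≤-pred m≤j))) (F-diag (suc j)) ⟩
    3 * (sumℕ (suc j) (λ m → (1 * m + suc (suc j)) * t m j) + suc j ! * 1)
      ≡⟨ cong (λ x → 3 * (x + suc j ! * 1)) (sumℕ-affine (suc j) 1 (suc (suc j)) (λ m → t m j)) ⟩
    3 * (1 * W + suc (suc j) * T j + suc j ! * 1)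
      ≡⟨ expand W j (T j) (suc j !) ⟩
    3 * W + (3 * suc (suc j) * T j + 3 * suc j !)
      ≡⟨ cong (_+ (3 * suc (suc j) * T j + 3 * suc j !)) (T-moment j) ⟩
    j * T j + (3 * suc (suc j) * T j + 3 * suc j !)
      ≡⟨ collect j (T j) (suc j !) ⟩
    (4 * j + 6) * T j + 3 * suc j !
      ∎
    where
    W = sumℕ (suc j) (λ m → m * t m j)
    step : ∀ {m} → m ≤ j → t m (suc j) ≡ (1 * m + suc (suc j)) * t m j
    step {m} m≤j = trans (t-step m≤j) (cong (λ x → (x + suc (suc j)) * t m j) (sym (ℕP.*-identityˡ m)))
    expand : ∀ w j x f → 3 * (1 * w + suc (suc j) * x + f * 1) ≡ 3 * w + (3 * suc (suc j) * x + 3 * f)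
    expand = solve-∀
    collect : ∀ j x f → j * x + (3 * suc (suc j) * x + 3 * f) ≡ (4 * j + 6) * x + 3 * f
    collect = solve-∀

  scaled-T-suc : ∀ j → 2 * 3 ^ suc j * T (suc j) ≡ (4 * j + 6) * (2 * 3 ^ j * T j) + 2 * suc j ! * 3 ^ suc j
  scaled-T-suc j = begin
    2 * (3 * 3 ^ j) * T (suc j)                           ≡⟨ pull-3 (3 ^ j) (T (suc j)) ⟩
    2 * 3 ^ j * (3 * T (suc j))                           ≡⟨ cong (2 * 3 ^ j *_) (T-suc j) ⟩
    2 * 3 ^ j * ((4 * j + 6) * T j + 3 * suc j !)         ≡⟨ push-3 j (3 ^ j) (T j) (suc j !) ⟩
    (4 * j + 6) * (2 * 3 ^ j * T j) + 2 * suc j ! * 3 ^ suc j ∎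
    where
    pull-3 : ∀ p x → 2 * (3 * p) * x ≡ 2 * p * (3 * x)
    pull-3 = solve-∀
    push-3 : ∀ j p x f → 2 * p * ((4 * j + 6) * x + 3 * f) ≡ (4 * j + 6) * (2 * p * x) + 2 * f * (3 * p)
    push-3 = solve-∀

open import Data.Integer as ℤ using (-_; +_)
import Data.Integer.Properties as ℤP
open import Data.Nat.Coprimality using (1-coprimeTo) renaming (sym to coprime-sym)
open import Data.Rational as ℚ using (ℚ; 0ℚ; 1ℚ; _+_; _*_; toℚᵘ)
import Data.Rational.Properties as ℚP
open import Data.Rational.Unnormalised as ℚᵘ using (mkℚᵘ; *≡*)
import Data.Rational.Unnormalised.Properties as ℚᵘP
open import Relation.Nullary.Decidable using (dec⇒maybe)
import Tactic.RingSolver as RingSolver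
open import Tactic.RingSolver.Core.AlmostCommutativeRing using (AlmostCommutativeRing; fromCommutativeRing)

ℚ-commutativeSemiring : CommutativeSemiring 0ℓ 0ℓ
ℚ-commutativeSemiring = CommutativeRing.commutativeSemiring ℚP.+-*-commutativeRing

open Summation.Properties ℚ-commutativeSemiring Σ< (λ _ → refl) (λ _ _ → refl)

ℚ-ring : AlmostCommutativeRing 0ℓ 0ℓ
ℚ-ring = fromCommutativeRing ℚP.+-*-commutativeRing (λ x → dec⇒maybe (0ℚ ℚP.≟ x))

toℚᵘ-ι : ∀ n → toℚᵘ (ι n) ≡ mkℚᵘ (+ n) 0
toℚᵘ-ι n = cong toℚᵘ (ℚP.normalize-coprime (coprime-sym (1-coprimeTo n)))

ι-suc : ∀ n → ι (suc n) ≡ 1ℚ + ι n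
ι-suc n = ℚP.toℚᵘ-injective (begin
  toℚᵘ (ι (suc n))           ≈⟨ ℚᵘP.≃-reflexive (toℚᵘ-ι (suc n)) ⟩
  mkℚᵘ (+ suc n) 0            ≈⟨ *≡* cross ⟩
  toℚᵘ 1ℚ ℚᵘ.+ mkℚᵘ (+ n) 0   ≈⟨ ℚᵘP.≃-reflexive (cong (λ x → toℚᵘ 1ℚ ℚᵘ.+ x) (toℚᵘ-ι n)) ⟨
  toℚᵘ 1ℚ ℚᵘ.+ toℚᵘ (ι n)    ≈⟨ ℚP.toℚᵘ-homo-+ 1ℚ (ι n) ⟨
  toℚᵘ (1ℚ + ι n)            ∎)
  where
  open ℚᵘP.≃-Reasoning
  cross : + suc n ℤ.* + 1 ≡ (+ 1 ℤ.+ + n ℤ.* + 1) ℤ.* + 1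
  cross = trans (cong (ℤ._* + 1) (ℤP.pos-+ 1 n))
                (cong (λ x → (+ 1 ℤ.+ x) ℤ.* + 1) (sym (ℤP.*-identityʳ (+ n))))

ι-+ : ∀ a b → ι (a ℕ.+ b) ≡ ι a + ι b
ι-+ zero    b = sym (ℚP.+-identityˡ (ι b))
ι-+ (suc a) b = begin
  ι (suc (a ℕ.+ b))  ≡⟨ ι-suc (a ℕ.+ b) ⟩
  1ℚ + ι (a ℕ.+ b)   ≡⟨ cong (_+_ 1ℚ) (ι-+ a b) ⟩
  1ℚ + (ι a + ι b)   ≡⟨ ℚP.+-assoc 1ℚ (ι a) (ι b) ⟨
  (1ℚ + ι a) + ι b   ≡⟨ cong (_+ ι b) (ι-suc a) ⟨
  ι (suc a) + ι b    ∎
  where open ≡-Reasoning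

ι-* : ∀ a b → ι (a ℕ.* b) ≡ ι a * ι b
ι-* zero    b = sym (ℚP.*-zeroˡ (ι b))
ι-* (suc a) b = begin
  ι (b ℕ.+ a ℕ.* b)  ≡⟨ ι-+ b (a ℕ.* b) ⟩
  ι b + ι (a ℕ.* b)  ≡⟨ cong (_+_ (ι b)) (ι-* a b) ⟩
  ι b + ι a * ι b    ≡⟨ distrib (ι a) (ι b) ⟩
  (1ℚ + ι a) * ι b   ≡⟨ cong (_* ι b) (ι-suc a) ⟨
  ι (suc a) * ι b    ∎
  where
  open ≡-Reasoning
  distrib : ∀ x y → y + x * y ≡ (1ℚ + x) * y
  distrib = RingSolver.solve-∀ ℚ-ring

ι-*-inv : ∀ d .{{_ : NonZero d}} → ι d * inv d ≡ 1ℚ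
ι-*-inv (suc d) = ℚP.toℚᵘ-injective (begin
  toℚᵘ (ι (suc d) * inv (suc d))             ≈⟨ ℚP.toℚᵘ-homo-* (ι (suc d)) (inv (suc d)) ⟩
  toℚᵘ (ι (suc d)) ℚᵘ.* toℚᵘ (inv (suc d))  ≈⟨ ℚᵘP.≃-reflexive (cong₂ ℚᵘ._*_ (toℚᵘ-ι (suc d)) toℚᵘ-inv) ⟩
  mkℚᵘ (+ suc d) 0 ℚᵘ.* mkℚᵘ (+ 1) d        ≈⟨ *≡* cross ⟩
  toℚᵘ 1ℚ                                    ∎)
  where
  open ℚᵘP.≃-Reasoning
  toℚᵘ-inv : toℚᵘ (inv (suc d)) ≡ mkℚᵘ (+ 1) d
  toℚᵘ-inv = cong toℚᵘ (ℚP.normalize-coprime (1-coprimeTo (suc d)))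
  cross : (+ suc d ℤ.* + 1) ℤ.* + 1 ≡ + 1 ℤ.* (+ 1 ℤ.* + suc d)
  cross = trans (ℤP.*-identityʳ (+ suc d ℤ.* + 1)) (trans (ℤP.*-identityʳ (+ suc d))
            (sym (trans (ℤP.*-identityˡ (+ 1 ℤ.* + suc d)) (ℤP.*-identityˡ (+ suc d)))))

Σ<-ι : ∀ n (f : ℕ → ℕ) → Σ< n (λ i → ι (f i)) ≡ ι (sumℕ n f)
Σ<-ι zero    f = refl
Σ<-ι (suc n) f = trans (cong (_+ ι (f n)) (Σ<-ι n f)) (sym (ι-+ (sumℕ n f) (f n)))

sgn-+ : ∀ a b → sgn (a ℕ.+ b) ≡ sgn a * sgn b
sgn-+ zero    b = sym (ℚP.*-identityˡ (sgn b))
sgn-+ (suc a) b = trans (cong ℚ.-_ (sgn-+ a b)) (ℚP.neg-distribˡ-* (sgn a) (sgn b))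

sgn-suc-suc : ∀ k → sgn (suc (suc k)) ≡ sgn k
sgn-suc-suc k = trans (sgn-+ 2 k) (ℚP.*-identityˡ (sgn k))

sgn-suc-+-suc : ∀ a b → sgn (suc a ℕ.+ suc b) ≡ sgn (a ℕ.+ b)
sgn-suc-+-suc a b = trans (cong (sgn ∘ suc) (ℕP.+-suc a b)) (sgn-suc-suc (a ℕ.+ b))

-- Poly-Bernoulli numbers of negative index

pow-oneMinusExpNeg : ∀ m n → ι (n !) * pow oneMinusExpNeg m n ≡ sgn (n ℕ.+ m) * ι (m !) * ι (S n m)
pow-oneMinusExpNeg zero    zero    = refl
pow-oneMinusExpNeg zero    (suc n) =
  trans (ℚP.*-zeroʳ (ι (suc n !))) (sym (ℚP.*-zeroʳ (sgn (suc n ℕ.+ 0) * 1ℚ)))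
pow-oneMinusExpNeg (suc m) n = begin
  ι (n !) * Σ< (suc n) (λ i → ω i * pow ω m (n ∸ i))
    ≡⟨ ∑-distribˡ (suc n) (ι (n !)) _ ⟩
  Σ< (suc n) (λ i → ι (n !) * (ω i * pow ω m (n ∸ i)))
    ≡⟨ ∑-head n _ ⟩
  ι (n !) * (0ℚ * pow ω m n) + Σ< n (λ i → ι (n !) * (ω (suc i) * pow ω m (n ∸ suc i)))
    ≡⟨ cong₂ _+_ (trans (cong (ι (n !) *_) (ℚP.*-zeroˡ (pow ω m n))) (ℚP.*-zeroʳ (ι (n !))))
                 (∑-cong n (λ i i<n → term i<n)) ⟩
  0ℚ + Σ< n (λ i → σ * ι ((n C suc i) ℕ.* S (n ∸ suc i) m))
    ≡⟨ trans (ℚP.+-identityˡ _) (sym (∑-distribˡ n σ _)) ⟩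
  σ * Σ< n (λ i → ι ((n C suc i) ℕ.* S (n ∸ suc i) m))
    ≡⟨ cong (σ *_) (trans (Σ<-ι n _) (cong ι (S-binomial-tail n m))) ⟩
  σ * ι (suc m ℕ.* S n (suc m))
    ≡⟨ cong (σ *_) (ι-* (suc m) (S n (suc m))) ⟩
  sgn (n ℕ.+ suc m) * ι (m !) * (ι (suc m) * ι (S n (suc m)))
    ≡⟨ absorb (sgn (n ℕ.+ suc m)) (ι (m !)) (ι (suc m)) (ι (S n (suc m))) ⟩
  sgn (n ℕ.+ suc m) * (ι (suc m) * ι (m !)) * ι (S n (suc m))
    ≡⟨ cong (λ x → sgn (n ℕ.+ suc m) * x * ι (S n (suc m))) (ι-* (suc m) (m !)) ⟨
  sgn (n ℕ.+ suc m) * ι (suc m !) * ι (S n (suc m))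
    ∎
  where
  open ≡-Reasoning
  ω = oneMinusExpNeg
  σ = sgn (n ℕ.+ suc m) * ι (m !)
  absorb : ∀ s f a x → s * f * (a * x) ≡ s * (a * f) * x
  absorb = RingSolver.solve-∀ ℚ-ring
  regroup : ∀ c a b s v p → c * (a * b) * (ℚ.- (s * v) * p) ≡ ℚ.- s * c * (a * v) * (b * p)
  regroup = RingSolver.solve-∀ ℚ-ring
  collect : ∀ s c t f x → s * c * 1ℚ * (t * f * x) ≡ s * t * f * (c * x)
  collect = RingSolver.solve-∀ ℚ-ring
  term : ∀ {i} → i < n →
         ι (n !) * (ω (suc i) * pow ω m (n ∸ suc i)) ≡ σ * ι ((n C suc i) ℕ.* S (n ∸ suc i) m)
  term {i} i<n = begin
    ι (n !) * (ℚ.- (sgn (suc i) * inv (suc i !)) * pow ω m r)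
      ≡⟨ cong (_* (ω (suc i) * pow ω m r)) (trans (cong ι (sym (binomial-factorials i<n)))
                                                  (trans (ι-* c _) (cong (ι c *_) (ι-* (suc i !) (r !))))) ⟩
    ι c * (ι (suc i !) * ι (r !)) * (ℚ.- (sgn (suc i) * inv (suc i !)) * pow ω m r)
      ≡⟨ regroup (ι c) (ι (suc i !)) (ι (r !)) (sgn (suc i)) (inv (suc i !)) (pow ω m r) ⟩
    sgn (suc (suc i)) * ι c * (ι (suc i !) * inv (suc i !)) * (ι (r !) * pow ω m r)
      ≡⟨ cong₂ (λ x y → sgn (suc (suc i)) * ι c * x * y)
               (ι-*-inv (suc i !) {{suc i ℕP.!≢0}}) (pow-oneMinusExpNeg m r) ⟩
    sgn (suc (suc i)) * ι c * 1ℚ * (sgn (r ℕ.+ m) * ι (m !) * ι (S r m))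
      ≡⟨ collect (sgn (suc (suc i))) (ι c) (sgn (r ℕ.+ m)) (ι (m !)) (ι (S r m)) ⟩
    sgn (suc (suc i)) * sgn (r ℕ.+ m) * ι (m !) * (ι c * ι (S r m))
      ≡⟨ cong₂ (λ x y → x * ι (m !) * y)
               (trans (sym (sgn-+ (suc (suc i)) (r ℕ.+ m))) (cong sgn exponent)) (sym (ι-* c (S r m))) ⟩
    σ * ι (c ℕ.* S r m)
      ∎
    where
    r = n ∸ suc i
    c = n C suc i
    exponent : suc (suc i) ℕ.+ (r ℕ.+ m) ≡ n ℕ.+ suc m
    exponent = begin
      suc (suc i ℕ.+ (r ℕ.+ m))  ≡⟨ cong suc (ℕP.+-assoc (suc i) r m) ⟨
      suc (suc i ℕ.+ r ℕ.+ m)    ≡⟨ cong (λ k → suc (k ℕ.+ m)) (ℕP.m+[n∸m]≡n i<n) ⟩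
      suc (n ℕ.+ m)              ≡⟨ ℕP.+-suc n m ⟨
      n ℕ.+ suc m                ∎

powNeg-negative : ∀ m k → powNeg m (- (+ k)) ≡ ι (m ^ k)
powNeg-negative m zero    = refl
powNeg-negative m (suc k) = refl

polyBernoulli-negative : ∀ N k →
  polyBernoulli N (- (+ k)) ≡ Σ< (suc N) (λ m → ι (m !) * (sgn (N ℕ.+ m) * ι (S N m) * ι (suc m ^ k)))
polyBernoulli-negative N k = begin
  ι (N !) * Σ< (suc N) (λ m → powNeg (suc m) (- (+ k)) * pow oneMinusExpNeg m N)
    ≡⟨ ∑-distribˡ (suc N) (ι (N !)) _ ⟩
  Σ< (suc N) (λ m → ι (N !) * (powNeg (suc m) (- (+ k)) * pow oneMinusExpNeg m N))
    ≡⟨ ∑-cong (suc N) (λ m _ → term m) ⟩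
  Σ< (suc N) (λ m → ι (m !) * (sgn (N ℕ.+ m) * ι (S N m) * ι (suc m ^ k)))
    ∎
  where
  open ≡-Reasoning
  swap : ∀ a x p → a * (x * p) ≡ x * (a * p)
  swap = RingSolver.solve-∀ ℚ-ring
  reorder : ∀ x s f z → x * (s * f * z) ≡ f * (s * z * x)
  reorder = RingSolver.solve-∀ ℚ-ring
  term : ∀ m → ι (N !) * (powNeg (suc m) (- (+ k)) * pow oneMinusExpNeg m N)
             ≡ ι (m !) * (sgn (N ℕ.+ m) * ι (S N m) * ι (suc m ^ k))
  term m = begin
    ι (N !) * (powNeg (suc m) (- (+ k)) * pow oneMinusExpNeg m N)
      ≡⟨ cong (λ x → ι (N !) * (x * pow oneMinusExpNeg m N)) (powNeg-negative (suc m) k) ⟩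
    ι (N !) * (ι (suc m ^ k) * pow oneMinusExpNeg m N)
      ≡⟨ swap (ι (N !)) (ι (suc m ^ k)) (pow oneMinusExpNeg m N) ⟩
    ι (suc m ^ k) * (ι (N !) * pow oneMinusExpNeg m N)
      ≡⟨ cong (ι (suc m ^ k) *_) (pow-oneMinusExpNeg m N) ⟩
    ι (suc m ^ k) * (sgn (N ℕ.+ m) * ι (m !) * ι (S N m))
      ≡⟨ reorder (ι (suc m ^ k)) (sgn (N ℕ.+ m)) (ι (m !)) (ι (S N m)) ⟩
    ι (m !) * (sgn (N ℕ.+ m) * ι (S N m) * ι (suc m ^ k))
      ∎

-- The Stirling transform

Σ<-δ-beyond : ∀ n c (f : ℕ → ℚ) → n ≤ c → Σ< n (λ j → f j * ι (δ c j)) ≡ 0ℚ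
Σ<-δ-beyond n c f n≤c = ∑-zeros n (λ j j<n →
  trans (cong (λ x → f j * ι x) (δ-≢ (λ c≡j → ℕP.<-irrefl (sym c≡j) (ℕP.<-≤-trans j<n n≤c))))
        (ℚP.*-zeroʳ (f j)))

Σ<-δ : ∀ n c (f : ℕ → ℚ) → c < n → Σ< n (λ j → f j * ι (δ c j)) ≡ f c
Σ<-δ n c f c<n = begin
  Σ< n (λ j → f j * ι (δ c j))                    ≡⟨ ∑-extend _ c<n beyond ⟨
  Σ< c (λ j → f j * ι (δ c j)) + f c * ι (δ c c)  ≡⟨ cong₂ _+_ (Σ<-δ-beyond c c f ℕP.≤-refl)
                                                             (cong (λ x → f c * ι x) (δ-refl c)) ⟩
  0ℚ + f c * 1ℚ                                    ≡⟨ trans (ℚP.+-identityˡ _) (ℚP.*-identityʳ (f c)) ⟩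
  f c                                              ∎
  where
  open ≡-Reasoning
  beyond : ∀ j → suc c ≤ j → j < n → f j * ι (δ c j) ≡ 0ℚ
  beyond j c<j _ = trans (cong (λ x → f j * ι x) (δ-≢ (ℕP.<⇒≢ c<j))) (ℚP.*-zeroʳ (f j))

stirlingWeight : ℕ → ℕ → ℚ
stirlingWeight n j = sgn (n ℕ.+ j) * ι (S (suc n) (suc j))

stirlingTransform : ℕ → (ℕ → ℚ) → ℚ
stirlingTransform n c = Σ< (suc n) (λ j → stirlingWeight n j * c j)

-- Summation by parts against S (n+2) (j+1) = (j+1) S (n+1) (j+1) + S (n+1) j.
stirlingTransform-suc : ∀ n (c d : ℕ → ℚ) → (∀ j → c (suc j) ≡ d j + ι (suc j) * c j) →
                        stirlingTransform (suc n) c ≡ stirlingTransform n d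
stirlingTransform-suc n c d c-suc = begin
  Σ< (suc (suc n)) (λ j → stirlingWeight (suc n) j * c j)  ≡⟨ ∑-cong (suc (suc n)) (λ j _ → split j) ⟩
  Σ< (suc (suc n)) (λ j → g j + h j)                       ≡⟨ ∑-distrib-+ (suc (suc n)) g h ⟩
  Σ< (suc (suc n)) g + Σ< (suc (suc n)) h                  ≡⟨ cong₂ _+_ (∑-extend g (ℕP.n≤1+n (suc n)) g-beyond)
                                                                         (sym (∑-head (suc n) h)) ⟨
  Σ< (suc n) g + (h 0 + Σ< (suc n) (h ∘ suc))              ≡⟨ cong (λ x → Σ< (suc n) g + x)
                                                                   (trans (cong (_+ Σ< (suc n) (h ∘ suc)) h-zero)
                                                                          (ℚP.+-identityˡ _)) ⟩
  Σ< (suc n) g + Σ< (suc n) (h ∘ suc)                      ≡⟨ ∑-distrib-+ (suc n) g (h ∘ suc) ⟨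
  Σ< (suc n) (λ j → g j + h (suc j))                       ≡⟨ ∑-cong (suc n) (λ j _ → combine j) ⟩
  stirlingTransform n d                                    ∎
  where
  open ≡-Reasoning
  g h : ℕ → ℚ
  g j = sgn (suc n ℕ.+ j) * ι (suc j ℕ.* S (suc n) (suc j)) * c j
  h j = sgn (suc n ℕ.+ j) * ι (S (suc n) j) * c j
  distrib : ∀ s a b x → s * (a + b) * x ≡ s * a * x + s * b * x
  distrib = RingSolver.solve-∀ ℚ-ring
  split : ∀ j → stirlingWeight (suc n) j * c j ≡ g j + h j
  split j = trans (cong (λ x → sgn (suc n ℕ.+ j) * x * c j) (ι-+ (suc j ℕ.* S (suc n) (suc j)) (S (suc n) j)))
                  (distrib (sgn (suc n ℕ.+ j)) _ _ (c j))
  g-beyond : ∀ j → suc n ≤ j → j < suc (suc n) → g j ≡ 0ℚ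
  g-beyond j n<j _ = begin
    sgn (suc n ℕ.+ j) * ι (suc j ℕ.* S (suc n) (suc j)) * c j
      ≡⟨ cong (λ x → sgn (suc n ℕ.+ j) * ι (suc j ℕ.* x) * c j) (S-vanish (s≤s n<j)) ⟩
    sgn (suc n ℕ.+ j) * ι (suc j ℕ.* 0) * c j
      ≡⟨ cong (λ x → sgn (suc n ℕ.+ j) * ι x * c j) (ℕP.*-zeroʳ (suc j)) ⟩
    sgn (suc n ℕ.+ j) * 0ℚ * c j
      ≡⟨ trans (cong (_* c j) (ℚP.*-zeroʳ (sgn (suc n ℕ.+ j)))) (ℚP.*-zeroˡ (c j)) ⟩
    0ℚ
      ∎
  h-zero : h 0 ≡ 0ℚ
  h-zero = trans (cong (_* c 0) (ℚP.*-zeroʳ (sgn (suc n ℕ.+ 0)))) (ℚP.*-zeroˡ (c 0))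
  cancel : ∀ s a x y e → ℚ.- s * (a * x) * y + s * x * (e + a * y) ≡ s * x * e
  cancel = RingSolver.solve-∀ ℚ-ring
  combine : ∀ j → g j + h (suc j) ≡ stirlingWeight n j * d j
  combine j = begin
    g j + h (suc j)
      ≡⟨ cong₂ (λ x y → sgn (suc n ℕ.+ j) * x * c j + y * s * c (suc j))
               (ι-* (suc j) (S (suc n) (suc j))) (sgn-suc-+-suc n j) ⟩
    ℚ.- σ * (ι (suc j) * s) * c j + σ * s * c (suc j)
      ≡⟨ cong (λ y → ℚ.- σ * (ι (suc j) * s) * c j + σ * s * y) (c-suc j) ⟩
    ℚ.- σ * (ι (suc j) * s) * c j + σ * s * (d j + ι (suc j) * c j)
      ≡⟨ cancel σ (ι (suc j)) s (c j) (d j) ⟩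
    σ * s * d j
      ∎
    where
    σ = sgn (n ℕ.+ j)
    s = ι (S (suc n) (suc j))

stirlingTransform-linear : ∀ n (a b : ℕ → ℚ) x →
  stirlingTransform n (λ j → a j + x * b j) ≡ stirlingTransform n a + x * stirlingTransform n b
stirlingTransform-linear n a b x = begin
  Σ< (suc n) (λ j → w j * (a j + x * b j))                    ≡⟨ ∑-cong (suc n) (λ j _ → distrib (w j) (a j) x (b j)) ⟩
  Σ< (suc n) (λ j → w j * a j + x * (w j * b j))              ≡⟨ ∑-distrib-+ (suc n) _ _ ⟩
  Σ< (suc n) (λ j → w j * a j) + Σ< (suc n) (λ j → x * (w j * b j))
    ≡⟨ cong (_+_ (stirlingTransform n a)) (∑-distribˡ (suc n) x _) ⟨
  stirlingTransform n a + x * stirlingTransform n b           ∎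
  where
  open ≡-Reasoning
  w = stirlingWeight n
  distrib : ∀ w a x b → w * (a + x * b) ≡ w * a + x * (w * b)
  distrib = RingSolver.solve-∀ ℚ-ring

stirlingTransform-∑ : ∀ n N (a : ℕ → ℚ) (c : ℕ → ℕ → ℚ) →
  Σ< N (λ m → a m * stirlingTransform n (c m)) ≡ stirlingTransform n (λ j → Σ< N (λ m → a m * c m j))
stirlingTransform-∑ n N a c = begin
  Σ< N (λ m → a m * Σ< (suc n) (λ j → w j * c m j))    ≡⟨ ∑-cong N (λ m _ → ∑-distribˡ (suc n) (a m) _) ⟩
  Σ< N (λ m → Σ< (suc n) (λ j → a m * (w j * c m j)))  ≡⟨ ∑-comm N (suc n) _ ⟩
  Σ< (suc n) (λ j → Σ< N (λ m → a m * (w j * c m j)))  ≡⟨ ∑-cong (suc n) (λ j _ →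
                                                            ∑-cong N (λ m _ → swap (a m) (w j) (c m j))) ⟩
  Σ< (suc n) (λ j → Σ< N (λ m → w j * (a m * c m j)))  ≡⟨ ∑-cong (suc n) (λ j _ → ∑-distribˡ N (w j) _) ⟨
  Σ< (suc n) (λ j → w j * Σ< N (λ m → a m * c m j))    ∎
  where
  open ≡-Reasoning
  w = stirlingWeight n
  swap : ∀ a w c → a * (w * c) ≡ w * (a * c)
  swap = RingSolver.solve-∀ ℚ-ring

stirlingTransform-indicator : ∀ n m →
  stirlingTransform n (λ j → ι (δ m (suc j))) ≡ sgn (suc n ℕ.+ m) * ι (S (suc n) m)
stirlingTransform-indicator n zero =
  trans (∑-zeros (suc n) (λ j _ → ℚP.*-zeroʳ (stirlingWeight n j))) (sym (ℚP.*-zeroʳ (sgn (suc n ℕ.+ 0))))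
stirlingTransform-indicator n (suc m) with ℕP.<-≤-connex m (suc n)
... | inj₁ m<1+n = begin
  stirlingTransform n (λ j → ι (δ m j))          ≡⟨ Σ<-δ (suc n) m (stirlingWeight n) m<1+n ⟩
  sgn (n ℕ.+ m) * ι (S (suc n) (suc m))          ≡⟨ cong (_* ι (S (suc n) (suc m))) (sgn-suc-+-suc n m) ⟨
  sgn (suc n ℕ.+ suc m) * ι (S (suc n) (suc m))  ∎
  where open ≡-Reasoning
... | inj₂ 1+n≤m = begin
  stirlingTransform n (λ j → ι (δ m j))          ≡⟨ Σ<-δ-beyond (suc n) m (stirlingWeight n) 1+n≤m ⟩
  0ℚ                                             ≡⟨ ℚP.*-zeroʳ (sgn (suc n ℕ.+ suc m)) ⟨
  sgn (suc n ℕ.+ suc m) * ι 0                    ≡⟨ cong (λ x → sgn (suc n ℕ.+ suc m) * ι x) (S-vanish (s≤s 1+n≤m)) ⟨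
  sgn (suc n ℕ.+ suc m) * ι (S (suc n) (suc m))  ∎
  where open ≡-Reasoning

stirlingTransform-F : ∀ n m →
  Σ< (suc n) (λ k → sgn (n ∸ k ℕ.+ m) * ι (S (n ∸ k) m) * ι (suc m ^ k))
    ≡ stirlingTransform n (λ j → ι (F m j))
stirlingTransform-F zero    zero    = refl
stirlingTransform-F zero    (suc m) = vanish (sgn (suc m))
  where
  vanish : ∀ s → 0ℚ + s * 0ℚ * 1ℚ ≡ 0ℚ + 1ℚ * 1ℚ * 0ℚ
  vanish = RingSolver.solve-∀ ℚ-ring
stirlingTransform-F (suc n) m = begin
  Σ< (suc (suc n)) (λ k → sgn (suc n ∸ k ℕ.+ m) * ι (S (suc n ∸ k) m) * ι (suc m ^ k))
    ≡⟨ ∑-head (suc n) (λ k → sgn (suc n ∸ k ℕ.+ m) * ι (S (suc n ∸ k) m) * ι (suc m ^ k)) ⟩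
  sgn (suc n ℕ.+ m) * ι (S (suc n) m) * 1ℚ + Σ< (suc n) (λ k → u k * ι (suc m ^ suc k))
    ≡⟨ cong₂ _+_ (ℚP.*-identityʳ (sgn (suc n ℕ.+ m) * ι (S (suc n) m)))
                 (trans (∑-cong (suc n) (λ k _ → factor k)) (sym (∑-distribˡ (suc n) (ι (suc m)) _))) ⟩
  sgn (suc n ℕ.+ m) * ι (S (suc n) m) + ι (suc m) * Σ< (suc n) (λ k → u k * ι (suc m ^ k))
    ≡⟨ cong₂ _+_ (stirlingTransform-indicator n m) (cong (ι (suc m) *_) (sym (stirlingTransform-F n m))) ⟨
  stirlingTransform n (λ j → ι (δ m (suc j))) + ι (suc m) * stirlingTransform n (λ j → ι (F m j))
    ≡⟨ stirlingTransform-linear n _ _ (ι (suc m)) ⟨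
  stirlingTransform n (λ j → ι (δ m (suc j)) + ι (suc m) * ι (F m j))
    ≡⟨ stirlingTransform-suc n _ _ F-suc ⟨
  stirlingTransform (suc n) (λ j → ι (F m j))
    ∎
  where
  open ≡-Reasoning
  u : ℕ → ℚ
  u k = sgn (n ∸ k ℕ.+ m) * ι (S (n ∸ k) m)
  swap : ∀ u a p → u * (a * p) ≡ a * (u * p)
  swap = RingSolver.solve-∀ ℚ-ring
  factor : ∀ k → u k * ι (suc m ^ suc k) ≡ ι (suc m) * (u k * ι (suc m ^ k))
  factor k = trans (cong (u k *_) (ι-* (suc m) (suc m ^ k))) (swap (u k) (ι (suc m)) (ι (suc m ^ k)))
  regroup : ∀ d a b f → d + (a + b) * f ≡ (d + a * f) + b * f
  regroup = RingSolver.solve-∀ ℚ-ring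
  F-suc : ∀ j → ι (F m (suc j)) ≡ (ι (δ m (suc j)) + ι (suc m) * ι (F m j)) + ι (suc j) * ι (F m j)
  F-suc j = begin
    ι (δ m (suc j) ℕ.+ (m ℕ.+ suc (suc j)) ℕ.* F m j)
      ≡⟨ trans (ι-+ (δ m (suc j)) _) (cong (_+_ (ι (δ m (suc j)))) (ι-* (m ℕ.+ suc (suc j)) (F m j))) ⟩
    ι (δ m (suc j)) + ι (m ℕ.+ suc (suc j)) * ι (F m j)
      ≡⟨ cong (λ x → ι (δ m (suc j)) + x * ι (F m j))
              (trans (cong ι (ℕP.+-suc m (suc j))) (ι-+ (suc m) (suc j))) ⟩
    ι (δ m (suc j)) + (ι (suc m) + ι (suc j)) * ι (F m j)
      ≡⟨ regroup (ι (δ m (suc j))) (ι (suc m)) (ι (suc j)) (ι (F m j)) ⟩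
    (ι (δ m (suc j)) + ι (suc m) * ι (F m j)) + ι (suc j) * ι (F m j)
      ∎

polyBernoulli-antidiagonal : ∀ n →
  Σ< (suc n) (λ k → polyBernoulli (n ∸ k) (- (+ k))) ≡ stirlingTransform n (λ j → ι (T j))
polyBernoulli-antidiagonal n = begin
  Σ< (suc n) (λ k → polyBernoulli (n ∸ k) (- (+ k)))
    ≡⟨ ∑-cong (suc n) (λ k _ → trans (polyBernoulli-negative (n ∸ k) k)
                                      (∑-extend _ (s≤s (ℕP.m∸n≤m n k)) (beyond k))) ⟩
  Σ< (suc n) (λ k → Σ< (suc n) (λ m → ι (m !) * u m k))
    ≡⟨ ∑-comm (suc n) (suc n) _ ⟩
  Σ< (suc n) (λ m → Σ< (suc n) (λ k → ι (m !) * u m k))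
    ≡⟨ ∑-cong (suc n) (λ m _ → trans (sym (∑-distribˡ (suc n) (ι (m !)) (u m)))
                                      (cong (ι (m !) *_) (stirlingTransform-F n m))) ⟩
  Σ< (suc n) (λ m → ι (m !) * stirlingTransform n (λ j → ι (F m j)))
    ≡⟨ stirlingTransform-∑ n (suc n) (λ m → ι (m !)) (λ m j → ι (F m j)) ⟩
  stirlingTransform n (λ j → Σ< (suc n) (λ m → ι (m !) * ι (F m j)))
    ≡⟨ ∑-cong (suc n) (λ j j≤n → cong (stirlingWeight n j *_) (Σ<-t (ℕP.≤-pred j≤n))) ⟩
  stirlingTransform n (λ j → ι (T j))
    ∎
  where
  open ≡-Reasoning
  u : ℕ → ℕ → ℚ
  u m k = sgn (n ∸ k ℕ.+ m) * ι (S (n ∸ k) m) * ι (suc m ^ k)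
  beyond : ∀ k m → suc (n ∸ k) ≤ m → m < suc n → ι (m !) * u m k ≡ 0ℚ
  beyond k m N<m _ = begin
    ι (m !) * (sgn (n ∸ k ℕ.+ m) * ι (S (n ∸ k) m) * ι (suc m ^ k))
      ≡⟨ cong (λ x → ι (m !) * (sgn (n ∸ k ℕ.+ m) * ι x * ι (suc m ^ k))) (S-vanish N<m) ⟩
    ι (m !) * (sgn (n ∸ k ℕ.+ m) * 0ℚ * ι (suc m ^ k))
      ≡⟨ cong (λ x → ι (m !) * (x * ι (suc m ^ k))) (ℚP.*-zeroʳ (sgn (n ∸ k ℕ.+ m))) ⟩
    ι (m !) * (0ℚ * ι (suc m ^ k))
      ≡⟨ trans (cong (ι (m !) *_) (ℚP.*-zeroˡ (ι (suc m ^ k)))) (ℚP.*-zeroʳ (ι (m !))) ⟩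
    0ℚ
      ∎
  Σ<-t : ∀ {j} → j ≤ n → Σ< (suc n) (λ m → ι (m !) * ι (F m j)) ≡ ι (T j)
  Σ<-t {j} j≤n = begin
    Σ< (suc n) (λ m → ι (m !) * ι (F m j))
      ≡⟨ ∑-extend _ (s≤s j≤n) (λ m j<m _ →
           trans (cong (λ x → ι (m !) * ι x) (F-vanish j<m)) (ℚP.*-zeroʳ (ι (m !)))) ⟨
    Σ< (suc j) (λ m → ι (m !) * ι (F m j))
      ≡⟨ ∑-cong (suc j) (λ m _ → sym (ι-* (m !) (F m j))) ⟩
    Σ< (suc j) (λ m → ι (t m j))
      ≡⟨ Σ<-ι (suc j) (λ m → t m j) ⟩
    ι (T j)
      ∎

-- The closed form of T

G : ℕ → ℚ
G j = Σ< (suc j) (λ i → ι (3 ^ i) * inv (suc (2 ℕ.* i) ℕ.* ((2 ℕ.* i) C i)))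

T-closed-form : ∀ j → ι (2 ℕ.* 3 ^ j ℕ.* T j) ≡ ι (K j) * G j
T-closed-form zero    = refl
T-closed-form (suc j) = begin
  ι (2 ℕ.* 3 ^ suc j ℕ.* T (suc j))
    ≡⟨ cong ι (scaled-T-suc j) ⟩
  ι (a ℕ.* (2 ℕ.* 3 ^ j ℕ.* T j) ℕ.+ f ℕ.* 3 ^ suc j)
    ≡⟨ trans (ι-+ (a ℕ.* (2 ℕ.* 3 ^ j ℕ.* T j)) (f ℕ.* 3 ^ suc j))
             (cong₂ _+_ (ι-* a (2 ℕ.* 3 ^ j ℕ.* T j)) (ι-* f (3 ^ suc j))) ⟩
  ι a * ι (2 ℕ.* 3 ^ j ℕ.* T j) + ι f * ι (3 ^ suc j)
    ≡⟨ cong₂ _+_ (cong (ι a *_) (T-closed-form j)) (sym (ℚP.*-identityʳ _)) ⟩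
  ι a * (ι (K j) * G j) + ι f * ι (3 ^ suc j) * 1ℚ
    ≡⟨ cong (λ y → ι a * (ι (K j) * G j) + ι f * ι (3 ^ suc j) * y) (sym (ι-*-inv M {{M≢0}})) ⟩
  ι a * (ι (K j) * G j) + ι f * ι (3 ^ suc j) * (ι M * inv M)
    ≡⟨ regroup (ι a) (ι (K j)) (G j) (ι f) (ι (3 ^ suc j)) (ι M) (inv M) ⟩
  ι a * ι (K j) * G j + ι f * ι M * (ι (3 ^ suc j) * inv M)
    ≡⟨ cong₂ (λ x y → x * G j + y * (ι (3 ^ suc j) * inv M)) (sym (ι-* a (K j))) (sym (ι-* f M)) ⟩
  ι (a ℕ.* K j) * G j + ι (f ℕ.* M) * (ι (3 ^ suc j) * inv M)
    ≡⟨ cong₂ (λ x y → ι x * G j + ι y * (ι (3 ^ suc j) * inv M))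
             (sym (K-suc j)) (sym (trans (K-suc j) (K-suc-factor j))) ⟩
  ι (K (suc j)) * G j + ι (K (suc j)) * (ι (3 ^ suc j) * inv M)
    ≡⟨ ℚP.*-distribˡ-+ (ι (K (suc j))) (G j) _ ⟨
  ι (K (suc j)) * G (suc j)
    ∎
  where
  open ≡-Reasoning
  a = 4 ℕ.* j ℕ.+ 6
  f = 2 ℕ.* suc j !
  M = suc (2 ℕ.* suc j) ℕ.* ((2 ℕ.* suc j) C suc j)
  M≢0 : NonZero M
  M≢0 = ℕP.m*n≢0 (suc (2 ℕ.* suc j)) _ {{_}} {{central-binomial-nonZero (suc j)}}
  regroup : ∀ a k g b p m i → a * (k * g) + b * p * (m * i) ≡ a * k * g + b * m * (p * i)
  regroup = RingSolver.solve-∀ ℚ-ring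

stirlingWeight-T : ∀ n j →
  stirlingWeight n j * ι (T j)
    ≡ sgn (suc n) * inv 2 * (sgn (suc j) * ι (suc j !) * ι (S (suc n) (suc j))
                               * ι ((2 ℕ.* suc j) C suc j) * inv (3 ^ j) * G j)
stirlingWeight-T n j = sym (begin
  sgn (suc n) * inv 2 * (sgn (suc j) * ι (suc j !) * s * ι c * inv p * G j)
    ≡⟨ regroup (sgn (suc n)) (inv 2) (sgn (suc j)) (ι (suc j !)) s (ι c) (inv p) (G j) ⟩
  sgn (suc n) * sgn (suc j) * s * (inv 2 * inv p * (ι (suc j !) * ι c * G j))
    ≡⟨ cong₂ (λ x y → x * s * (inv 2 * inv p * y)) sign (trans (cong (_* G j) (sym (ι-* (suc j !) c)))
                                                             (sym (T-closed-form j))) ⟩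
  sgn (n ℕ.+ j) * s * (inv 2 * inv p * ι (2 ℕ.* p ℕ.* T j))
    ≡⟨ cong (λ x → sgn (n ℕ.+ j) * s * (inv 2 * inv p * x))
            (trans (ι-* (2 ℕ.* p) (T j)) (cong (_* ι (T j)) (ι-* 2 p))) ⟩
  sgn (n ℕ.+ j) * s * (inv 2 * inv p * (ι 2 * ι p * ι (T j)))
    ≡⟨ cong (sgn (n ℕ.+ j) * s *_) (pair-up (inv 2) (inv p) (ι 2) (ι p) (ι (T j))) ⟩
  sgn (n ℕ.+ j) * s * (ι 2 * inv 2 * (ι p * inv p) * ι (T j))
    ≡⟨ cong₂ (λ x y → sgn (n ℕ.+ j) * s * (x * y * ι (T j))) (ι-*-inv 2) (ι-*-inv p {{ℕP.m^n≢0 3 j}}) ⟩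
  sgn (n ℕ.+ j) * s * (1ℚ * 1ℚ * ι (T j))
    ≡⟨ cong (sgn (n ℕ.+ j) * s *_)
            (trans (cong (_* ι (T j)) (ℚP.*-identityˡ 1ℚ)) (ℚP.*-identityˡ (ι (T j)))) ⟩
  stirlingWeight n j * ι (T j)
    ∎)
  where
  open ≡-Reasoning
  s = ι (S (suc n) (suc j))
  c = (2 ℕ.* suc j) C suc j
  p = 3 ^ j
  regroup : ∀ σ h τ f x c i g → σ * h * (τ * f * x * c * i * g) ≡ σ * τ * x * (h * i * (f * c * g))
  regroup = RingSolver.solve-∀ ℚ-ring
  pair-up : ∀ h i a b x → h * i * (a * b * x) ≡ a * h * (b * i) * x
  pair-up = RingSolver.solve-∀ ℚ-ring
  sign : sgn (suc n) * sgn (suc j) ≡ sgn (n ℕ.+ j)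
  sign = trans (sym (sgn-+ (suc n) (suc j))) (sgn-suc-+-suc n j)

mainTheorem7 : (n : ℕ) →
    Σ< (suc n) (λ k → polyBernoulli (n ∸ k) (- (+ k)))
      ≡ sgn (suc n) * inv 2 *
        Σ< (suc n) (λ j′ →
          sgn (suc j′) * ι (suc j′ !) * ι (S (suc n) (suc j′))
            * ι ((2 Data.Nat.* suc j′) C suc j′) * inv (3 Data.Nat.^ j′)
            * Σ< (suc j′) (λ i → ι (3 Data.Nat.^ i)
                 * inv ((suc (2 Data.Nat.* i)) Data.Nat.* ((2 Data.Nat.* i) C i))))
mainTheorem7 n = begin
  Σ< (suc n) (λ k → polyBernoulli (n ∸ k) (- (+ k)))   ≡⟨ polyBernoulli-antidiagonal n ⟩
  stirlingTransform n (λ j → ι (T j))                  ≡⟨ ∑-cong (suc n) (λ j _ → stirlingWeight-T n j) ⟩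
  Σ< (suc n) (λ j → sgn (suc n) * inv 2 * r j)         ≡⟨ ∑-distribˡ (suc n) (sgn (suc n) * inv 2) r ⟨
  sgn (suc n) * inv 2 * Σ< (suc n) r                   ∎
  where
  open ≡-Reasoning
  r : ℕ → ℚ
  r j = sgn (suc j) * ι (suc j !) * ι (S (suc n) (suc j)) * ι ((2 ℕ.* suc j) C suc j) * inv (3 ^ j) * G j
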